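{- Let $G=(V_G,E_G)$ be a finite connected weighted graph as described in the context and fix $v_0\in V_G$. For every divisor $D$ there exists a unique $v_0$-reduced divisor $D_0$ such that $D_0\sim D$.
   Context: $G=(V_G,E_G)$ is a connected graph with finite vertex set, no loops, edges unordered pairs of distinct vertices, each edge $\{x,y\}$ with positive rational weight $C_{x,y}=C_{y,x}$; $N(x)=\{y:\{x,y\}\in E_G\}$. For $f:V_G\to\mathbb Z$, $\Delta f(x)=\sum_{y\in N(x)}C_{x,y}(f(x)-f(y))$. $i(x)=\min\{|\Delta f(x)|: f:V_G\to\mathbb Z,\ f(x)=0,\ \Delta f(x)\ne0\}$. A divisor is $D=\sum_x\ell(x)i(x)1_{\{x\}}$ with $\ell:V_G\to\mathbb Z$. $D\sim D'$ iff $D'=D+\Delta f$ for some $f:V_G\to\mathbb Z$ (with $\Delta f$ viewed as the divisor $\sum_x\Delta f(x)1_{\{x\}}$). A divisor $D=\sum_x\ell(x)i(x)1_{\{x\}}$ is $v_0$-reduced if (P1) $\ell(z)i(z)\ge0$ for all $z\in V_G\setminus\{v_0\}$, and (P2) for every nonempty $A\subset V_G\setminus\{v_0\}$ there is $x\in A$ with $\ell(x)i(x)<\mathrm{outdeg}_A(x):=\sum_{y\in N(x)\setminus A}C_{x,y}$. -}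

module Defs where

open import Data.Nat using (ℕ; zero; suc)
open import Data.Fin using (Fin; zero; suc)
open import Data.Fin.Subset using (Subset; _∈_; _∉_; Nonempty)
open import Data.Bool using (if_then_else_)
open import Data.Vec using (lookup)
open import Data.Integer using (ℤ; +_)
open import Data.Rational using (ℚ; 0ℚ; _+_; _*_; _-_; ∣_∣; _<_; _≤_; _/_)
open import Data.Product using (Σ; ∃; _×_)
open import Relation.Binary.PropositionalEquality using (_≡_; _≢_)

-- Weighted graph on vertex set Fin n, encoded by a weight function
-- C : Fin n → Fin n → ℚ with C x y = C_{x,y} > 0 if {x,y} is an edge
-- and C x y = 0 otherwise.  N(x) = { y : 0 < C x y }.

Σᶠ : ∀ {n} → (Fin n → ℚ) → ℚ
Σᶠ {zero}  f = 0ℚ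
Σᶠ {suc n} f = f zero + Σᶠ (λ y → f (suc y))

ι : ℤ → ℚ
ι z = z / 1

Weights : ℕ → Set
Weights n = Fin n → Fin n → ℚ

Adj : ∀ {n} → Weights n → Fin n → Fin n → Set
Adj C x y = 0ℚ < C x y

IsWeightedGraph : ∀ {n} → Weights n → Set
IsWeightedGraph C =
  (∀ x y → C x y ≡ C y x) × (∀ x y → 0ℚ ≤ C x y) × (∀ x → C x x ≡ 0ℚ)

data Reach {n} (C : Weights n) : Fin n → Fin n → Set where
  here : ∀ {x} → Reach C x x
  step : ∀ {x y z} → Adj C x y → Reach C y z → Reach C x z

Connected : ∀ {n} → Weights n → Set
Connected C = ∀ x y → Reach C x y

-- Laplacian: Δf(x) = Σ_{y ∈ N(x)} C_{x,y} (f(x) - f(y))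
-- (non-neighbours contribute 0 since C x y = 0 for them).
Δ : ∀ {n} → Weights n → (Fin n → ℤ) → Fin n → ℚ
Δ C f x = Σᶠ (λ y → C x y * (ι (f x) - ι (f y)))

IsIndex : ∀ {n} → Weights n → Fin n → ℚ → Set
IsIndex C x q =
  (∃ λ (f : _ → ℤ) → (f x ≡ + 0) × (Δ C f x ≢ 0ℚ) × (∣ Δ C f x ∣ ≡ q))
  × (∀ (f : _ → ℤ) → f x ≡ + 0 → Δ C f x ≢ 0ℚ → q ≤ ∣ Δ C f x ∣)

-- The divisor D = Σ_x ℓ(x) i(x) 1_{x}, given by its coefficients ℓ;
-- its value at x is ℓ(x) i(x).
divAt : ∀ {n} → (Fin n → ℚ) → (Fin n → ℤ) → Fin n → ℚ
divAt i ℓ x = ι (ℓ x) * i x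

Equiv : ∀ {n} → Weights n → (Fin n → ℚ) → (Fin n → ℤ) → (Fin n → ℤ) → Set
Equiv C i ℓ ℓ' = ∃ λ (f : _ → ℤ) → ∀ x → divAt i ℓ' x ≡ divAt i ℓ x + Δ C f x

outdeg : ∀ {n} → Weights n → Subset n → Fin n → ℚ
outdeg C A x = Σᶠ (λ y → if lookup A y then 0ℚ else C x y)

Reduced : ∀ {n} → Weights n → (Fin n → ℚ) → Fin n → (Fin n → ℤ) → Set
Reduced C i v₀ ℓ =
  (∀ z → z ≢ v₀ → 0ℚ ≤ divAt i ℓ z)
  × (∀ (A : Subset _) → Nonempty A → v₀ ∉ A →
       ∃ λ x → x ∈ A × (divAt i ℓ x < outdeg C A x))

module Submission where

-- Uniqueness is a maximum principle. If D and D′ = D + Δh are both v₀-reduced and h is not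
-- maximal at v₀, the set where h is maximal avoids v₀, and at each of its points
-- D′ = D + Δh ≥ Δh ≥ outdeg, contradicting (P2) for D′. So h, and symmetrically −h, is
-- maximal at v₀; h is constant and D′ = D.
--
-- Existence: on a connected graph there is G : V → ℕ with G(v₀) = 0 and ΔG ≥ c > 0 away from
-- v₀, built outwards from v₀ layer by layer. Adding a large multiple of ΔG makes D
-- nonnegative away from v₀; then, while (P2) fails for some A, fire A (subtract Δ1_A). This
-- keeps (P1) and lowers the energy Σ f ΔG by at least c, and by self-adjointness of Δ the
-- energy equals Σ G (D + Δf) − Σ G D ≥ −Σ G D, so the process stops. Finally, minimality
-- of i(x) and division with remainder make Δf(x) an integer multiple of i(x), so the
-- reduced divisor again has the form Σ ℓ₀(x) i(x) 1_{x}.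

open import Defs
open import Data.Nat using (ℕ)
open import Data.Fin using (Fin)
open import Data.Integer using (ℤ)
open import Data.Rational using (ℚ)
open import Data.Product using (∃; _×_)
open import Relation.Binary.PropositionalEquality using (_≡_)

open import Algebra.Bundles using (Ring)
import Algebra.Solver.Ring as RingSolver
open import Algebra.Solver.Ring.AlmostCommutativeRing
  using (fromCommutativeRing; _-Raw-AlmostCommutative⟶_)
open import Data.Bool using (Bool; true; false; not; _∨_; if_then_else_)
import Data.Bool as Bool
open import Data.Bool.Properties using (∨-zeroʳ)
open import Data.Empty using (⊥-elim)
open import Data.Fin using (zero; suc; _≟_)
open import Data.Fin.Properties using (any?; all?; ¬∀⟶∃¬)
open import Data.Fin.Subset using (Subset; _∈_; _∉_; Nonempty)
open import Data.Fin.Subset.Properties using (anySubset?; nonempty?; _∈?_)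
open import Data.Integer using (+_; -[1+_])
import Data.Integer as ℤ
import Data.Integer.DivMod as ℤ
import Data.Integer.Properties as ℤP
open import Data.List using (allFin)
open import Data.List.Extrema ℤP.≤-totalOrder using (argmax; f[xs]≤f[argmax])
open import Data.List.Membership.Propositional.Properties using (∈-allFin)
import Data.List.Relation.Unary.All as All
open import Data.Maybe using (Maybe; just; nothing)
open import Data.Nat using (zero; suc; z≤n; s≤s)
import Data.Nat as ℕ
open import Data.Nat.Coprimality using (1-coprimeTo) renaming (sym to coprime-sym)
import Data.Nat.Properties as ℕP
open import Data.Product using (_,_; proj₁; proj₂)
open import Data.Rational
  using ( mkℚ; ↥_; 0ℚ; 1ℚ; _+_; _*_; _-_; -_; 1/_; ∣_∣; floor; _≤_; _<_; *≤*; *<*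
        ; NonZero; Positive; >-nonZero; nonNegative; positive)
import Data.Rational.Properties as ℚP
open import Algebra.Properties.Semiring.Sum (Ring.semiring ℚP.+-*-ring)
  using (sum; sum-replicate-zero; ∑-distrib-+; ∑-comm; *-distribˡ-sum)
open import Data.Sum using (_⊎_; inj₁; inj₂)
open import Data.Unit using (⊤; tt)
open import Data.Vec using (lookup; tabulate)
import Data.Vec.Properties as Vec
open import Function using (id; _∘_)
open import Relation.Nullary using (¬_; ¬?; Dec; yes; no; does; _×-dec_; _→-dec_)
open import Relation.Nullary.Decidable using (dec-true; decidable-stable)
open import Relation.Unary using (Decidable)
open import Relation.Binary.PropositionalEquality
  using (_≢_; _≗_; refl; sym; trans; cong; cong₂; subst; subst₂; module ≡-Reasoning)

ι≡mkℚ : ∀ z → ι z ≡ mkℚ z 0 (coprime-sym (1-coprimeTo ℤ.∣ z ∣))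
ι≡mkℚ (+ n)    = ℚP.normalize-coprime _
ι≡mkℚ -[1+ n ] = cong -_ (ℚP.normalize-coprime {suc n} {0} _)

ι-homo-+ : ∀ a b → ι (a ℤ.+ b) ≡ ι a + ι b
ι-homo-+ a b rewrite ι≡mkℚ a | ι≡mkℚ b =
  cong ι (cong₂ ℤ._+_ (sym (ℤP.*-identityʳ a)) (sym (ℤP.*-identityʳ b)))

ι-homo-* : ∀ a b → ι (a ℤ.* b) ≡ ι a * ι b
ι-homo-* a b rewrite ι≡mkℚ a | ι≡mkℚ b = refl

ι-homo-neg : ∀ a → ι (ℤ.- a) ≡ - ι a
ι-homo-neg a rewrite ι≡mkℚ a | ι≡mkℚ (ℤ.- a) = mkℚ-neg a
  where
  mkℚ-neg : ∀ a → mkℚ (ℤ.- a) 0 (coprime-sym (1-coprimeTo ℤ.∣ ℤ.- a ∣))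
                ≡ - mkℚ a 0 (coprime-sym (1-coprimeTo ℤ.∣ a ∣))
  mkℚ-neg (+ zero)  = refl
  mkℚ-neg (+ suc n) = refl
  mkℚ-neg -[1+ n ]  = refl

ι-homo-- : ∀ a b → ι (a ℤ.- b) ≡ ι a - ι b
ι-homo-- a b = trans (ι-homo-+ a (ℤ.- b)) (cong (λ t → ι a + t) (ι-homo-neg b))

ι-mono-≤ : ∀ {a b} → a ℤ.≤ b → ι a ≤ ι b
ι-mono-≤ {a} {b} a≤b rewrite ι≡mkℚ a | ι≡mkℚ b =
  *≤* (subst₂ ℤ._≤_ (sym (ℤP.*-identityʳ a)) (sym (ℤP.*-identityʳ b)) a≤b)

ι-nonNeg : ∀ m → 0ℚ ≤ ι (+ m)
ι-nonNeg m = ι-mono-≤ {+ 0} {+ m} (ℤ.+≤+ z≤n)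

ι-morphism : ℤ.+-*-rawRing -Raw-AlmostCommutative⟶ fromCommutativeRing ℚP.+-*-commutativeRing
ι-morphism = record
  { ⟦_⟧ = ι ; +-homo = ι-homo-+ ; *-homo = ι-homo-* ; -‿homo = ι-homo-neg
  ; 0-homo = refl ; 1-homo = refl }

ι-≟ : ∀ a b → Maybe (ι a ≡ ι b)
ι-≟ a b with a ℤ.≟ b
... | yes a≡b = just (cong ι a≡b)
... | no _    = nothing

open RingSolver ℤ.+-*-rawRing (fromCommutativeRing ℚP.+-*-commutativeRing) ι-morphism ι-≟

1≤ι[j]-ι[i] : ∀ {i j} → i ℤ.< j → 1ℚ ≤ ι j - ι i
1≤ι[j]-ι[i] {i} {j} i<j = subst (_≤ ι j - ι i) (solve 1 (λ p → (con (+ 1) :+ p) :- p := con (+ 1)) refl (ι i))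
  (ℚP.+-monoˡ-≤ (- ι i) (subst (_≤ ι j) (ι-homo-+ (+ 1) i) (ι-mono-≤ (ℤP.i<j⇒suc[i]≤j i<j))))

p≤p+q : ∀ {p q} → 0ℚ ≤ q → p ≤ p + q
p≤p+q {p} 0≤q = subst (_≤ p + _) (ℚP.+-identityʳ p) (ℚP.+-monoʳ-≤ p 0≤q)

q≤p+q : ∀ {p q} → 0ℚ ≤ p → q ≤ p + q
q≤p+q {p} {q} 0≤p = subst (_≤ p + q) (ℚP.+-identityˡ q) (ℚP.+-monoˡ-≤ q 0≤p)

p<p+q : ∀ {p q} → 0ℚ < q → p < p + q
p<p+q {p} 0<q = subst (_< p + _) (ℚP.+-identityʳ p) (ℚP.+-monoʳ-< p 0<q)

p≤q⇒0≤q-p : ∀ {p q} → p ≤ q → 0ℚ ≤ q - p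
p≤q⇒0≤q-p {p} {q} p≤q = subst (_≤ q - p) (ℚP.+-inverseʳ p) (ℚP.+-monoˡ-≤ (- p) p≤q)

0≤p+∣p∣ : ∀ p → 0ℚ ≤ p + ∣ p ∣
0≤p+∣p∣ p with ℚP.∣p∣≡p∨∣p∣≡-p p
... | inj₁ ∣p∣≡p  = subst (λ t → 0ℚ ≤ p + t) (sym ∣p∣≡p)
                     (ℚP.≤-trans (ℚP.∣p∣≡p⇒0≤p ∣p∣≡p) (p≤p+q (ℚP.∣p∣≡p⇒0≤p ∣p∣≡p)))
... | inj₂ ∣p∣≡-p = ℚP.≤-reflexive (sym (trans (cong (λ t → p + t) ∣p∣≡-p) (ℚP.+-inverseʳ p)))

0≤p*q : ∀ {p q} → 0ℚ ≤ p → 0ℚ ≤ q → 0ℚ ≤ p * q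
0≤p*q {p} {q} 0≤p 0≤q =
  ℚP.nonNegative⁻¹ _ {{ℚP.nonNeg*nonNeg⇒nonNeg p {{nonNegative 0≤p}} q {{nonNegative 0≤q}}}}

*-monoʳ-≤-0≤ : ∀ {r p q} → 0ℚ ≤ r → p ≤ q → r * p ≤ r * q
*-monoʳ-≤-0≤ {r} 0≤r = ℚP.*-monoˡ-≤-nonNeg r {{nonNegative 0≤r}}

Σᶠ≡sum : ∀ {n} (f : Fin n → ℚ) → Σᶠ f ≡ sum f
Σᶠ≡sum {zero}  f = refl
Σᶠ≡sum {suc n} f = cong (λ s → f zero + s) (Σᶠ≡sum (f ∘ suc))

Σᶠ-cong : ∀ {n} {f g : Fin n → ℚ} → f ≗ g → Σᶠ f ≡ Σᶠ g
Σᶠ-cong {zero}  f≗g = refl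
Σᶠ-cong {suc n} f≗g = cong₂ _+_ (f≗g zero) (Σᶠ-cong (f≗g ∘ suc))

Σᶠ-zero : ∀ n → Σᶠ {n} (λ _ → 0ℚ) ≡ 0ℚ
Σᶠ-zero n = trans (Σᶠ≡sum (λ (_ : Fin n) → 0ℚ)) (sum-replicate-zero n)

Σᶠ-distrib-+ : ∀ {n} (f g : Fin n → ℚ) → Σᶠ (λ y → f y + g y) ≡ Σᶠ f + Σᶠ g
Σᶠ-distrib-+ f g = trans (Σᶠ≡sum (λ y → f y + g y))
  (trans (∑-distrib-+ f g) (sym (cong₂ _+_ (Σᶠ≡sum f) (Σᶠ≡sum g))))

*-distribˡ-Σᶠ : ∀ {n} (a : ℚ) (f : Fin n → ℚ) → a * Σᶠ f ≡ Σᶠ (λ y → a * f y)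
*-distribˡ-Σᶠ a f = trans (cong (a *_) (Σᶠ≡sum f))
  (trans (*-distribˡ-sum a f) (sym (Σᶠ≡sum (λ y → a * f y))))

Σᶠ-neg : ∀ {n} (f : Fin n → ℚ) → Σᶠ (λ y → - f y) ≡ - Σᶠ f
Σᶠ-neg f = begin
  Σᶠ (λ y → - f y)             ≡⟨ Σᶠ-cong (λ y → solve 1 (λ a → :- a := con (ℤ.- + 1) :* a) refl (f y)) ⟩
  Σᶠ (λ y → ι (ℤ.- + 1) * f y) ≡⟨ *-distribˡ-Σᶠ (ι (ℤ.- + 1)) f ⟨
  ι (ℤ.- + 1) * Σᶠ f           ≡⟨ solve 1 (λ a → con (ℤ.- + 1) :* a := :- a) refl (Σᶠ f) ⟩
  - Σᶠ f                       ∎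
  where open ≡-Reasoning

Σᶠ-distrib-- : ∀ {n} (f g : Fin n → ℚ) → Σᶠ (λ y → f y - g y) ≡ Σᶠ f - Σᶠ g
Σᶠ-distrib-- f g = trans (Σᶠ-distrib-+ f (λ y → - g y)) (cong (λ t → Σᶠ f + t) (Σᶠ-neg g))

Σᶠ-comm : ∀ {m n} (h : Fin m → Fin n → ℚ) → Σᶠ (λ x → Σᶠ (h x)) ≡ Σᶠ (λ y → Σᶠ (λ x → h x y))
Σᶠ-comm h = begin
  Σᶠ (λ x → Σᶠ (h x))           ≡⟨ Σᶠ-cong (λ x → Σᶠ≡sum (h x)) ⟩
  Σᶠ (λ x → sum (h x))          ≡⟨ Σᶠ≡sum (λ x → sum (h x)) ⟩
  sum (λ x → sum (h x))         ≡⟨ ∑-comm h ⟩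
  sum (λ y → sum (λ x → h x y)) ≡⟨ Σᶠ≡sum (λ y → sum (λ x → h x y)) ⟨
  Σᶠ (λ y → sum (λ x → h x y))  ≡⟨ Σᶠ-cong (λ y → Σᶠ≡sum (λ x → h x y)) ⟨
  Σᶠ (λ y → Σᶠ (λ x → h x y))   ∎
  where open ≡-Reasoning

Σᶠ-mono-≤ : ∀ {n} {f g : Fin n → ℚ} → (∀ y → f y ≤ g y) → Σᶠ f ≤ Σᶠ g
Σᶠ-mono-≤ {zero}  f≤g = ℚP.≤-refl
Σᶠ-mono-≤ {suc n} f≤g = ℚP.+-mono-≤ (f≤g zero) (Σᶠ-mono-≤ (f≤g ∘ suc))

Σᶠ-nonNeg : ∀ {n} {f : Fin n → ℚ} → (∀ y → 0ℚ ≤ f y) → 0ℚ ≤ Σᶠ f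
Σᶠ-nonNeg {n} {f} 0≤f = subst (_≤ Σᶠ f) (Σᶠ-zero n) (Σᶠ-mono-≤ 0≤f)

term≤Σᶠ : ∀ {n} {f : Fin n → ℚ} → (∀ y → 0ℚ ≤ f y) → ∀ x → f x ≤ Σᶠ f
term≤Σᶠ {suc n} 0≤f zero    = p≤p+q (Σᶠ-nonNeg (0≤f ∘ suc))
term≤Σᶠ {suc n} 0≤f (suc x) = ℚP.≤-trans (term≤Σᶠ (0≤f ∘ suc) x) (q≤p+q (0≤f zero))

indicator : ∀ {n} → (Fin n → Bool) → Fin n → ℤ
indicator b y = + (if b y then 1 else 0)

module _ {n : ℕ} (C : Weights n) where

  Δ-cong : ∀ {f g : Fin n → ℤ} → f ≗ g → Δ C f ≗ Δ C g
  Δ-cong f≗g x = Σᶠ-cong (λ y → cong₂ (λ a b → C x y * (ι a - ι b)) (f≗g x) (f≗g y))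

  Δ-homo-+ : ∀ (f g : Fin n → ℤ) x → Δ C (λ y → f y ℤ.+ g y) x ≡ Δ C f x + Δ C g x
  Δ-homo-+ f g x = trans (Σᶠ-cong edge) (Σᶠ-distrib-+ (λ y → C x y * (ι (f x) - ι (f y))) _)
    where
    edge : ∀ y → C x y * (ι (f x ℤ.+ g x) - ι (f y ℤ.+ g y))
               ≡ C x y * (ι (f x) - ι (f y)) + C x y * (ι (g x) - ι (g y))
    edge y = trans (cong₂ (λ a b → C x y * (a - b)) (ι-homo-+ (f x) (g x)) (ι-homo-+ (f y) (g y)))
      (solve 5 (λ c a b d e → c :* ((a :+ b) :- (d :+ e)) := c :* (a :- d) :+ c :* (b :- e))
             refl (C x y) (ι (f x)) (ι (g x)) (ι (f y)) (ι (g y)))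

  Δ-homo-* : ∀ (a : ℤ) (f : Fin n → ℤ) x → Δ C (λ y → a ℤ.* f y) x ≡ ι a * Δ C f x
  Δ-homo-* a f x = trans (Σᶠ-cong edge) (sym (*-distribˡ-Σᶠ (ι a) (λ y → C x y * (ι (f x) - ι (f y)))))
    where
    edge : ∀ y → C x y * (ι (a ℤ.* f x) - ι (a ℤ.* f y)) ≡ ι a * (C x y * (ι (f x) - ι (f y)))
    edge y = trans (cong₂ (λ p q → C x y * (p - q)) (ι-homo-* a (f x)) (ι-homo-* a (f y)))
      (solve 4 (λ c k p q → c :* (k :* p :- k :* q) := k :* (c :* (p :- q)))
             refl (C x y) (ι a) (ι (f x)) (ι (f y)))

  Δ-homo-neg : ∀ (f : Fin n → ℤ) x → Δ C (λ y → ℤ.- f y) x ≡ - Δ C f x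
  Δ-homo-neg f x = begin
    Δ C (λ y → ℤ.- f y) x          ≡⟨ Δ-cong (λ y → sym (ℤP.-1*i≡-i (f y))) x ⟩
    Δ C (λ y → ℤ.- + 1 ℤ.* f y) x  ≡⟨ Δ-homo-* (ℤ.- + 1) f x ⟩
    ι (ℤ.- + 1) * Δ C f x          ≡⟨ solve 1 (λ p → con (ℤ.- + 1) :* p := :- p) refl (Δ C f x) ⟩
    - Δ C f x                      ∎
    where open ≡-Reasoning

  Δ-homo-- : ∀ (f g : Fin n → ℤ) x → Δ C (λ y → f y ℤ.- g y) x ≡ Δ C f x - Δ C g x
  Δ-homo-- f g x = trans (Δ-homo-+ f (λ y → ℤ.- g y) x) (cong (λ t → Δ C f x + t) (Δ-homo-neg g x))

  Δ-const : ∀ (k : ℤ) x → Δ C (λ _ → k) x ≡ 0ℚ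
  Δ-const k x = trans (Σᶠ-cong (λ y → solve 2 (λ c a → c :* (a :- a) := con (+ 0)) refl (C x y) (ι k)))
                      (Σᶠ-zero n)

  Δ-indicator-true : ∀ (b : Fin n → Bool) x → b x ≡ true →
                     Δ C (indicator b) x ≡ Σᶠ (λ y → if b y then 0ℚ else C x y)
  Δ-indicator-true b x bx≡true = Σᶠ-cong edge
    where
    edge : ∀ y → C x y * (ι (indicator b x) - ι (indicator b y)) ≡ (if b y then 0ℚ else C x y)
    edge y rewrite bx≡true with b y
    ... | true  = solve 1 (λ c → c :* (con (+ 1) :- con (+ 1)) := con (+ 0)) refl (C x y)
    ... | false = solve 1 (λ c → c :* (con (+ 1) :- con (+ 0)) := c) refl (C x y)

  module _ (C≥0 : ∀ x y → 0ℚ ≤ C x y) where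

    Δ-indicator-false : ∀ (b : Fin n → Bool) x → b x ≡ false → Δ C (indicator b) x ≤ 0ℚ
    Δ-indicator-false b x bx≡false = subst (Δ C (indicator b) x ≤_) (Σᶠ-zero n) (Σᶠ-mono-≤ edge)
      where
      edge : ∀ y → C x y * (ι (indicator b x) - ι (indicator b y)) ≤ 0ℚ
      edge y rewrite bx≡false with b y
      ... | true  = subst (_≤ 0ℚ) (solve 1 (λ c → :- c := c :* (con (+ 0) :- con (+ 1))) refl (C x y))
                          (ℚP.neg-antimono-≤ (C≥0 x y))
      ... | false = ℚP.≤-reflexive (solve 1 (λ c → c :* (con (+ 0) :- con (+ 0)) := con (+ 0)) refl (C x y))

    -degree≤Δ-indicator : ∀ (b : Fin n → Bool) x → - Σᶠ (C x) ≤ Δ C (indicator b) x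
    -degree≤Δ-indicator b x = subst (_≤ Δ C (indicator b) x) (Σᶠ-neg (C x)) (Σᶠ-mono-≤ edge)
      where
      edge : ∀ y → - C x y ≤ C x y * (ι (indicator b x) - ι (indicator b y))
      -c≤0 : ∀ y → - C x y ≤ 0ℚ
      -c≤0 y = ℚP.neg-antimono-≤ (C≥0 x y)
      edge y with b x | b y
      ... | true  | true  = subst (- C x y ≤_) (solve 1 (λ c → con (+ 0) := c :* (con (+ 1) :- con (+ 1))) refl (C x y)) (-c≤0 y)
      ... | true  | false = subst (- C x y ≤_) (solve 1 (λ c → c := c :* (con (+ 1) :- con (+ 0))) refl (C x y))
                                  (ℚP.≤-trans (-c≤0 y) (C≥0 x y))
      ... | false | true  = ℚP.≤-reflexive (solve 1 (λ c → :- c := c :* (con (+ 0) :- con (+ 1))) refl (C x y))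
      ... | false | false = subst (- C x y ≤_) (solve 1 (λ c → con (+ 0) := c :* (con (+ 0) :- con (+ 0))) refl (C x y)) (-c≤0 y)

module _ {n : ℕ} (C : Weights n) (C-sym : ∀ x y → C x y ≡ C y x) where

  private
    diagonal cross : (a b : Fin n → ℤ) → ℚ
    diagonal a b = Σᶠ (λ x → Σᶠ (λ y → C x y * (ι (a x) * ι (b x))))
    cross    a b = Σᶠ (λ x → Σᶠ (λ y → C x y * (ι (a x) * ι (b y))))

    pairing≡diagonal-cross : ∀ a b → Σᶠ (λ x → ι (a x) * Δ C b x) ≡ diagonal a b - cross a b
    pairing≡diagonal-cross a b = trans (Σᶠ-cong expand)
      (Σᶠ-distrib-- (λ x → Σᶠ (λ y → C x y * (ι (a x) * ι (b x))))
                    (λ x → Σᶠ (λ y → C x y * (ι (a x) * ι (b y)))))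
      where
      expand : ∀ x → ι (a x) * Δ C b x
                   ≡ Σᶠ (λ y → C x y * (ι (a x) * ι (b x))) - Σᶠ (λ y → C x y * (ι (a x) * ι (b y)))
      expand x = trans (*-distribˡ-Σᶠ (ι (a x)) (λ y → C x y * (ι (b x) - ι (b y))))
        (trans (Σᶠ-cong (λ y → solve 4 (λ p c q r → p :* (c :* (q :- r)) := c :* (p :* q) :- c :* (p :* r))
                                        refl (ι (a x)) (C x y) (ι (b x)) (ι (b y))))
               (Σᶠ-distrib-- (λ y → C x y * (ι (a x) * ι (b x))) (λ y → C x y * (ι (a x) * ι (b y)))))

    diagonal-comm : ∀ a b → diagonal a b ≡ diagonal b a
    diagonal-comm a b = Σᶠ-cong (λ x → Σᶠ-cong (λ y → cong (C x y *_) (ℚP.*-comm (ι (a x)) (ι (b x)))))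

    cross-comm : ∀ a b → cross a b ≡ cross b a
    cross-comm a b = trans (Σᶠ-comm (λ x y → C x y * (ι (a x) * ι (b y))))
      (Σᶠ-cong (λ y → Σᶠ-cong (λ x → cong₂ _*_ (C-sym x y) (ℚP.*-comm (ι (a x)) (ι (b y))))))

  Δ-selfAdjoint : ∀ a b → Σᶠ (λ x → ι (a x) * Δ C b x) ≡ Σᶠ (λ x → ι (b x) * Δ C a x)
  Δ-selfAdjoint a b = begin
    Σᶠ (λ x → ι (a x) * Δ C b x) ≡⟨ pairing≡diagonal-cross a b ⟩
    diagonal a b - cross a b     ≡⟨ cong₂ _-_ (diagonal-comm a b) (cross-comm a b) ⟩
    diagonal b a - cross b a     ≡⟨ pairing≡diagonal-cross b a ⟨
    Σᶠ (λ x → ι (b x) * Δ C a x) ∎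
    where open ≡-Reasoning

-- Reduced divisors and the maximum principle

-- (P1) and (P2) for rational-valued divisors; Reduced C i v₀ ℓ unfolds to IsReduced C v₀ (divAt i ℓ).
EffectiveAway : ∀ {n} → Fin n → (Fin n → ℚ) → Set
EffectiveAway v₀ D = ∀ z → z ≢ v₀ → 0ℚ ≤ D z

Unfireable : ∀ {n} → Weights n → Fin n → (Fin n → ℚ) → Set
Unfireable C v₀ D = ∀ A → Nonempty A → v₀ ∉ A → ∃ λ x → x ∈ A × (D x < outdeg C A x)

IsReduced : ∀ {n} → Weights n → Fin n → (Fin n → ℚ) → Set
IsReduced C v₀ D = EffectiveAway v₀ D × Unfireable C v₀ D

IsReduced-resp-≗ : ∀ {n} {C : Weights n} {v₀ : Fin n} {D D′ : Fin n → ℚ} →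
                   D ≗ D′ → IsReduced C v₀ D → IsReduced C v₀ D′
IsReduced-resp-≗ {C = C} D≗D′ (D≥0 , unfireable) =
  (λ z z≢v₀ → subst (0ℚ ≤_) (D≗D′ z) (D≥0 z z≢v₀)) ,
  (λ A A≢∅ v₀∉A → let (x , x∈A , Dx<outdeg) = unfireable A A≢∅ v₀∉A
                  in x , x∈A , subst (_< outdeg C A x) (D≗D′ x) Dx<outdeg)

levelSet : ∀ {n} → (Fin n → ℤ) → ℤ → Subset n
levelSet h M = tabulate (λ y → does (h y ℤ.≟ M))

module _ {n : ℕ} (h : Fin n → ℤ) (M : ℤ) where

  lookup-levelSet : ∀ y → lookup (levelSet h M) y ≡ does (h y ℤ.≟ M)
  lookup-levelSet = Vec.lookup∘tabulate (λ y → does (h y ℤ.≟ M))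

  ∈-levelSet⁺ : ∀ {y} → h y ≡ M → y ∈ levelSet h M
  ∈-levelSet⁺ {y} hy≡M = Vec.lookup⇒[]= y (levelSet h M)
    (trans (lookup-levelSet y) (dec-true (h y ℤ.≟ M) hy≡M))

  ∈-levelSet⁻ : ∀ {y} → y ∈ levelSet h M → h y ≡ M
  ∈-levelSet⁻ {y} y∈ with h y ℤ.≟ M | trans (sym (lookup-levelSet y)) (Vec.[]=⇒lookup y∈)
  ... | yes hy≡M | _ = hy≡M

  outdeg-levelSet≤Δ : ∀ (C : Weights n) → (∀ x y → 0ℚ ≤ C x y) →
                      (∀ y → h y ℤ.≤ M) → ∀ x → h x ≡ M → outdeg C (levelSet h M) x ≤ Δ C h x
  outdeg-levelSet≤Δ C C≥0 h≤M x hx≡M = Σᶠ-mono-≤ edge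
    where
    edge : ∀ y → (if lookup (levelSet h M) y then 0ℚ else C x y) ≤ C x y * (ι (h x) - ι (h y))
    edge y rewrite lookup-levelSet y | hx≡M with h y ℤ.≟ M
    ... | yes _   = 0≤p*q (C≥0 x y) (p≤q⇒0≤q-p (ι-mono-≤ (h≤M y)))
    ... | no hy≢M = subst (_≤ C x y * (ι M - ι (h y))) (ℚP.*-identityʳ (C x y))
                      (*-monoʳ-≤-0≤ (C≥0 x y) (1≤ι[j]-ι[i] (ℤP.≤∧≢⇒< (h≤M y) hy≢M)))

maximum-attained : ∀ {n} (h : Fin n → ℤ) (v : Fin n) → ∃ λ a → ∀ y → h y ℤ.≤ h a
maximum-attained {n} h v = argmax h v (allFin n) , λ y → All.lookup (f[xs]≤f[argmax] v (allFin n)) (∈-allFin y)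

module _ {n : ℕ} (C : Weights n) (C≥0 : ∀ x y → 0ℚ ≤ C x y) (v₀ : Fin n) where

  maximum-at-root : ∀ (D D′ : Fin n → ℚ) (h : Fin n → ℤ) → (∀ x → D′ x ≡ D x + Δ C h x) →
                    EffectiveAway v₀ D → Unfireable C v₀ D′ → ∀ y → h y ℤ.≤ h v₀
  maximum-at-root D D′ h D′≡D+Δh D≥0 unfireable with maximum-attained h v₀
  ... | a , h≤ha with h a ℤ.≤? h v₀
  ...   | yes ha≤hv₀ = λ y → ℤP.≤-trans (h≤ha y) ha≤hv₀
  ...   | no  ha≰hv₀ = ⊥-elim (ℚP.<-irrefl refl (ℚP.<-≤-trans D′x<outdeg outdeg≤D′x))
    where
    A = levelSet h (h a)
    v₀∉A : v₀ ∉ A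
    v₀∉A v₀∈A = ha≰hv₀ (ℤP.≤-reflexive (sym (∈-levelSet⁻ h (h a) v₀∈A)))
    witness = unfireable A (a , ∈-levelSet⁺ h (h a) refl) v₀∉A
    x = proj₁ witness
    x∈A = proj₁ (proj₂ witness)
    D′x<outdeg : D x + Δ C h x < outdeg C A x
    D′x<outdeg = subst (_< outdeg C A x) (D′≡D+Δh x) (proj₂ (proj₂ witness))
    outdeg≤D′x : outdeg C A x ≤ D x + Δ C h x
    outdeg≤D′x = ℚP.≤-trans (outdeg-levelSet≤Δ h (h a) C C≥0 h≤ha x (∈-levelSet⁻ h (h a) x∈A))
                   (q≤p+q (D≥0 x (λ x≡v₀ → v₀∉A (subst (_∈ A) x≡v₀ x∈A))))

  IsReduced-unique : ∀ (D D′ : Fin n → ℚ) (h : Fin n → ℤ) → IsReduced C v₀ D → IsReduced C v₀ D′ →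
                     (∀ x → D′ x ≡ D x + Δ C h x) → D′ ≗ D
  IsReduced-unique D D′ h (D≥0 , D-unfireable) (D′≥0 , D′-unfireable) D′≡D+Δh x = begin
    D′ x                     ≡⟨ D′≡D+Δh x ⟩
    D x + Δ C h x            ≡⟨ cong (λ t → D x + t) (Δ-cong C h-constant x) ⟩
    D x + Δ C (λ _ → h v₀) x ≡⟨ cong (λ t → D x + t) (Δ-const C (h v₀) x) ⟩
    D x + 0ℚ                 ≡⟨ ℚP.+-identityʳ (D x) ⟩
    D x                      ∎
    where
    open ≡-Reasoning
    D≡D′+Δ[-h] : ∀ x → D x ≡ D′ x + Δ C (λ y → ℤ.- h y) x
    D≡D′+Δ[-h] x = sym (trans (cong₂ _+_ (D′≡D+Δh x) (Δ-homo-neg C h x))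
                              (solve 2 (λ d e → d :+ e :- e := d) refl (D x) (Δ C h x)))
    h-constant : ∀ y → h y ≡ h v₀
    h-constant y = ℤP.≤-antisym
      (maximum-at-root D D′ h D′≡D+Δh D≥0 D′-unfireable y)
      (ℤP.neg-cancel-≤ (maximum-at-root D′ D (λ y → ℤ.- h y) D≡D′+Δ[-h] D′≥0 D-unfireable y))

-- Integrality of the Laplacian

floor-spec : ∀ p → ι (floor p) ≤ p × p < ι (floor p ℤ.+ + 1)
floor-spec (mkℚ num den _) = lower , upper
  where
  d = + suc den
  k = num ℤ./ d
  r = num ℤ.% d
  num≡r+kd : num ≡ + r ℤ.+ k ℤ.* d
  num≡r+kd = ℤ.a≡a%n+[a/n]*n num d
  lower : ι k ≤ mkℚ num den _
  lower rewrite ι≡mkℚ k = *≤* (subst (k ℤ.* d ℤ.≤_) (trans (sym num≡r+kd) (sym (ℤP.*-identityʳ num)))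
                                  (ℤP.i≤j+i (k ℤ.* d) (+ r)))
  upper : mkℚ num den _ < ι (k ℤ.+ + 1)
  upper rewrite ι≡mkℚ (k ℤ.+ + 1) = *<* (subst₂ ℤ._<_
    (trans (sym num≡r+kd) (sym (ℤP.*-identityʳ num)))
    d+kd≡[k+1]d
    (ℤP.+-monoˡ-< (k ℤ.* d) (ℤ.+<+ (ℤ.n%d<d num d))))
    where
    open ≡-Reasoning
    d+kd≡[k+1]d : d ℤ.+ k ℤ.* d ≡ (k ℤ.+ + 1) ℤ.* d
    d+kd≡[k+1]d = begin
      d ℤ.+ k ℤ.* d           ≡⟨ ℤP.+-comm d (k ℤ.* d) ⟩
      k ℤ.* d ℤ.+ d           ≡⟨ cong (λ t → k ℤ.* d ℤ.+ t) (ℤP.*-identityˡ d) ⟨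
      k ℤ.* d ℤ.+ + 1 ℤ.* d   ≡⟨ ℤP.*-distribʳ-+ d k (+ 1) ⟨
      (k ℤ.+ + 1) ℤ.* d       ∎

division-with-remainder : ∀ r q → 0ℚ < q → ∃ λ k → 0ℚ ≤ r - ι k * q × r - ι k * q < q
division-with-remainder r q 0<q = k , p≤q⇒0≤q-p kq≤r , r-kq<q
  where
  instance
    q≢0 : NonZero q
    q≢0 = >-nonZero 0<q
    q>0 : Positive q
    q>0 = positive 0<q
  k = floor (r * 1/ q)
  r/q*q≡r : r * 1/ q * q ≡ r
  r/q*q≡r = trans (ℚP.*-assoc r (1/ q) q) (trans (cong (r *_) (ℚP.*-inverseˡ q)) (ℚP.*-identityʳ r))
  kq≤r : ι k * q ≤ r
  kq≤r = subst (ι k * q ≤_) r/q*q≡r (ℚP.*-monoʳ-≤-nonNeg q {{ℚP.pos⇒nonNeg q}} (proj₁ (floor-spec (r * 1/ q))))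
  r<[k+1]q : r < ι (k ℤ.+ + 1) * q
  r<[k+1]q = subst (_< ι (k ℤ.+ + 1) * q) r/q*q≡r (ℚP.*-monoˡ-<-pos q (proj₂ (floor-spec (r * 1/ q))))
  r-kq<q : r - ι k * q < q
  r-kq<q = subst (r - ι k * q <_) (trans (cong (λ t → t * q - ι k * q) (ι-homo-+ k (+ 1)))
                                         (solve 2 (λ a b → (a :+ con (+ 1)) :* b :- a :* b := b) refl (ι k) q))
             (ℚP.+-monoˡ-< (- (ι k * q)) r<[k+1]q)

≤ι∣↥∣ : ∀ p → p ≤ ι (+ ℤ.∣ ↥ p ∣)
≤ι∣↥∣ (mkℚ num den _) rewrite ι≡mkℚ (+ ℤ.∣ num ∣) = *≤* (num*1≤∣num∣*d num)
  where
  num*1≤∣num∣*d : ∀ z → z ℤ.* + 1 ℤ.≤ + ℤ.∣ z ∣ ℤ.* + suc den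
  num*1≤∣num∣*d (+ m) rewrite sym (ℤP.pos-* m 1) | sym (ℤP.pos-* m (suc den)) =
    ℤ.+≤+ (ℕP.*-monoʳ-≤ m (s≤s z≤n))
  num*1≤∣num∣*d -[1+ m ] rewrite ℤP.*-identityʳ -[1+ m ] | sym (ℤP.pos-* (suc m) (suc den)) = ℤ.-≤+

archimedean : ∀ a b → 0ℚ < b → ∃ λ (N : ℕ) → a ≤ ι (+ N) * b
archimedean a b 0<b = M ℕ.* K , (begin
  a                            ≤⟨ ≤ι∣↥∣ a ⟩
  ι (+ M)                      ≡⟨ ℚP.*-identityʳ (ι (+ M)) ⟨
  ι (+ M) * 1ℚ                 ≤⟨ *-monoʳ-≤-0≤ (ι-nonNeg M) 1≤Kb ⟩
  ι (+ M) * (ι (+ K) * b)      ≡⟨ ℚP.*-assoc (ι (+ M)) (ι (+ K)) b ⟨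
  ι (+ M) * ι (+ K) * b        ≡⟨ cong (_* b) (trans (cong ι (ℤP.pos-* M K)) (ι-homo-* (+ M) (+ K))) ⟨
  ι (+ (M ℕ.* K)) * b          ∎)
  where
  open ℚP.≤-Reasoning
  instance
    b≢0 : NonZero b
    b≢0 = >-nonZero 0<b
  M = ℤ.∣ ↥ a ∣
  K = ℤ.∣ ↥ (1/ b) ∣
  1≤Kb : 1ℚ ≤ ι (+ K) * b
  1≤Kb = subst (_≤ ι (+ K) * b) (ℚP.*-inverseˡ b)
           (ℚP.*-monoʳ-≤-nonNeg b {{nonNegative (ℚP.<⇒≤ 0<b)}} (≤ι∣↥∣ (1/ b)))

module _ {n : ℕ} (C : Weights n) {x : Fin n} {q : ℚ} (q-index : IsIndex C x q) where

  index-positive : 0ℚ < q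
  index-positive = let (f , _ , Δf≢0 , ∣Δf∣≡q) , _ = q-index in ℚP.≰⇒> λ q≤0 →
    Δf≢0 (ℚP.∣p∣≡0⇒p≡0 _ (trans ∣Δf∣≡q (ℚP.≤-antisym q≤0 (subst (0ℚ ≤_) ∣Δf∣≡q (ℚP.0≤∣p∣ _)))))

  index-attained : ∃ λ (u : Fin n → ℤ) → u x ≡ + 0 × Δ C u x ≡ q
  index-attained = attained (proj₁ q-index)
    where
    attained : (∃ λ f → f x ≡ + 0 × Δ C f x ≢ 0ℚ × ∣ Δ C f x ∣ ≡ q) → ∃ λ u → u x ≡ + 0 × Δ C u x ≡ q
    attained (f , fx≡0 , _ , ∣Δf∣≡q) with ℚP.∣p∣≡p∨∣p∣≡-p (Δ C f x)
    ... | inj₁ ∣Δf∣≡Δf  = f , fx≡0 , trans (sym ∣Δf∣≡Δf) ∣Δf∣≡q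
    ... | inj₂ ∣Δf∣≡-Δf = (λ y → ℤ.- f y) , cong ℤ.-_ fx≡0 ,
                          trans (Δ-homo-neg C f x) (trans (sym ∣Δf∣≡-Δf) ∣Δf∣≡q)

  Δ-multiple-of-index : ∀ (h : Fin n → ℤ) → ∃ λ k → Δ C h x ≡ ι k * q
  Δ-multiple-of-index h = k , (begin
    Δ C h x              ≡⟨ solve 2 (λ r s → r := (r :- s) :+ s) refl (Δ C h x) (ι k * q) ⟩
    ρ + ι k * q          ≡⟨ cong (_+ ι k * q) ρ≡0 ⟩
    0ℚ + ι k * q         ≡⟨ ℚP.+-identityˡ (ι k * q) ⟩
    ι k * q              ∎)
    where
    open ≡-Reasoning
    division = division-with-remainder (Δ C h x) q index-positive
    k = proj₁ division
    ρ = Δ C h x - ι k * q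
    u = proj₁ index-attained
    -- w(x) = 0 and Δw(x) = ρ, so by minimality of i(x) the remainder ρ ∈ [0, i(x)) vanishes.
    w : Fin n → ℤ
    w y = (h y ℤ.- h x) ℤ.- k ℤ.* u y
    wx≡0 : w x ≡ + 0
    wx≡0 = cong₂ ℤ._-_ (ℤP.+-inverseʳ (h x)) (trans (cong (k ℤ.*_) (proj₁ (proj₂ index-attained))) (ℤP.*-zeroʳ k))
    Δw≡ρ : Δ C w x ≡ ρ
    Δw≡ρ = begin
      Δ C w x                                                ≡⟨ Δ-homo-- C (λ y → h y ℤ.- h x) (λ y → k ℤ.* u y) x ⟩
      Δ C (λ y → h y ℤ.- h x) x - Δ C (λ y → k ℤ.* u y) x    ≡⟨ cong₂ _-_ (Δ-homo-- C h (λ _ → h x) x) (Δ-homo-* C k u x) ⟩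
      (Δ C h x - Δ C (λ _ → h x) x) - ι k * Δ C u x          ≡⟨ cong₂ (λ s t → (Δ C h x - s) - ι k * t) (Δ-const C (h x) x) (proj₂ (proj₂ index-attained)) ⟩
      (Δ C h x - 0ℚ) - ι k * q                               ≡⟨ cong (_- ι k * q) (ℚP.+-identityʳ (Δ C h x)) ⟩
      ρ                                                      ∎
    ρ≡0 : ρ ≡ 0ℚ
    ρ≡0 with ρ ℚP.≟ 0ℚ
    ... | yes ρ≡0 = ρ≡0
    ... | no  ρ≢0 = ⊥-elim (ℚP.<-irrefl refl (ℚP.<-≤-trans (proj₂ (proj₂ division)) q≤ρ))
      where
      q≤ρ : q ≤ ρ
      q≤ρ = subst (q ≤_) (trans (cong ∣_∣ Δw≡ρ) (ℚP.0≤p⇒∣p∣≡p (proj₁ (proj₂ division))))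
                  (proj₂ q-index w wx≡0 (λ Δw≡0 → ρ≢0 (trans (sym Δw≡ρ) Δw≡0)))

divAt-+Δ : ∀ {n} (C : Weights n) {i : Fin n → ℚ} → (∀ x → IsIndex C x (i x)) →
           ∀ (ℓ f : Fin n → ℤ) → ∃ λ ℓ′ → ∀ x → divAt i ℓ′ x ≡ divAt i ℓ x + Δ C f x
divAt-+Δ C {i} i-index ℓ f = (λ x → ℓ x ℤ.+ k x) , λ x → begin
  ι (ℓ x ℤ.+ k x) * i x       ≡⟨ cong (_* i x) (ι-homo-+ (ℓ x) (k x)) ⟩
  (ι (ℓ x) + ι (k x)) * i x   ≡⟨ ℚP.*-distribʳ-+ (i x) (ι (ℓ x)) (ι (k x)) ⟩
  divAt i ℓ x + ι (k x) * i x ≡⟨ cong (λ t → divAt i ℓ x + t) (proj₂ (Δ-multiple-of-index C (i-index x) f)) ⟨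
  divAt i ℓ x + Δ C f x       ∎
  where
  open ≡-Reasoning
  k : Fin _ → ℤ
  k x = proj₁ (Δ-multiple-of-index C (i-index x) f)

-- A superharmonic potential

positive-lowerBound : ∀ {n} (P : Fin n → Set) → Decidable P → (f : Fin n → ℚ) →
                      (∀ x → P x → 0ℚ < f x) → ∃ λ m → 0ℚ < m × (∀ x → P x → m ≤ f x)
positive-lowerBound {zero} P P? f f>0 = 1ℚ , ℚP.positive⁻¹ 1ℚ , λ ()
positive-lowerBound {suc n} P P? f f>0
  with positive-lowerBound (P ∘ suc) (P? ∘ suc) (f ∘ suc) (f>0 ∘ suc) | P? zero
... | m , m>0 , m≤f | no ¬P₀ = m , m>0 , λ { zero P₀ → ⊥-elim (¬P₀ P₀) ; (suc x) → m≤f x }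
... | m , m>0 , m≤f | yes P₀ with f zero ℚP.≤? m
...   | yes f₀≤m = f zero , f>0 zero P₀ , λ { zero _ → ℚP.≤-refl ; (suc x) Px → ℚP.≤-trans f₀≤m (m≤f x Px) }
...   | no  f₀≰m = m , m>0 , λ { zero _ → ℚP.<⇒≤ (ℚP.≰⇒> f₀≰m) ; (suc x) → m≤f x }

upper-bound : ∀ {n} (k : Fin n → ℕ) → ∃ λ K → ∀ x → k x ℕ.≤ K
upper-bound {zero}  k = 0 , λ ()
upper-bound {suc n} k with upper-bound (k ∘ suc)
... | K , k≤K = k zero ℕ.⊔ K , λ { zero    → ℕP.m≤m⊔n (k zero) K
                               ; (suc x) → ℕP.≤-trans (k≤K x) (ℕP.m≤n⊔m (k zero) K) }

module Potential {n : ℕ} (C : Weights n) (C≥0 : ∀ x y → 0ℚ ≤ C x y) (connected : Connected C) (v₀ : Fin n) where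

  private
    weight-lowerBound : ∃ λ w → 0ℚ < w × (∀ x y → 0ℚ < C x y → w ≤ C x y)
    weight-lowerBound =
      let row x = positive-lowerBound (λ y → 0ℚ < C x y) (λ y → 0ℚ ℚP.<? C x y) (C x) (λ _ → id)
          (w , w>0 , w≤row) = positive-lowerBound (λ _ → ⊤) (λ _ → yes tt) (proj₁ ∘ row) (λ x _ → proj₁ (proj₂ (row x)))
      in w , w>0 , λ x y 0<Cxy → ℚP.≤-trans (w≤row x tt) (proj₂ (proj₂ (row x)) y 0<Cxy)

  w₀ : ℚ
  w₀ = proj₁ weight-lowerBound

  w₀>0 : 0ℚ < w₀
  w₀>0 = proj₁ (proj₂ weight-lowerBound)

  w₀≤C : ∀ x y → 0ℚ < C x y → w₀ ≤ C x y
  w₀≤C = proj₂ (proj₂ weight-lowerBound)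

  degree : Fin n → ℚ
  degree x = Σᶠ (C x)

  totalDegree : ℚ
  totalDegree = Σᶠ degree

  degree≤totalDegree : ∀ x → degree x ≤ totalDegree
  degree≤totalDegree = term≤Σᶠ (λ x → Σᶠ-nonNeg (C≥0 x))

  Q : ℕ
  Q = proj₁ (archimedean (w₀ + totalDegree) w₀ w₀>0)

  w₀+totalDegree≤Qw₀ : w₀ + totalDegree ≤ ι (+ Q) * w₀
  w₀+totalDegree≤Qw₀ = proj₂ (archimedean (w₀ + totalDegree) w₀ w₀>0)

  adjacent? : ∀ (S : Fin n → Bool) x → Dec (∃ λ y → S y ≡ true × 0ℚ < C x y)
  adjacent? S x = any? (λ y → (S y Bool.≟ true) ×-dec (0ℚ ℚP.<? C x y))

  ball : ℕ → Fin n → Bool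
  ball zero    x = does (x ≟ v₀)
  ball (suc k) x = ball k x ∨ does (adjacent? (ball k) x)

  ball-root : ∀ k → ball k v₀ ≡ true
  ball-root zero    = dec-true (v₀ ≟ v₀) refl
  ball-root (suc k) rewrite ball-root k = refl

  ball-zero : ∀ {x} → ball zero x ≡ true → x ≡ v₀
  ball-zero {x} x∈ with x ≟ v₀
  ... | yes x≡v₀ = x≡v₀

  ball-suc : ∀ {k x} → ball k x ≡ true → ball (suc k) x ≡ true
  ball-suc x∈ rewrite x∈ = refl

  ball-suc⁻ : ∀ {k x} → ball (suc k) x ≡ false → ball k x ≡ false
  ball-suc⁻ {k} {x} x∉ with ball k x
  ... | false = refl

  ball-step : ∀ {k x y} → ball k y ≡ true → 0ℚ < C x y → ball (suc k) x ≡ true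
  ball-step {k} {x} {y} y∈ 0<Cxy =
    trans (cong (ball k x ∨_) (dec-true (adjacent? (ball k) x) (y , y∈ , 0<Cxy))) (∨-zeroʳ (ball k x))

  ball-new : ∀ {k x} → ball (suc k) x ≡ true → ball k x ≡ false → ∃ λ y → ball k y ≡ true × 0ℚ < C x y
  ball-new {k} {x} x∈ x∉ with ball k x | adjacent? (ball k) x
  ... | false | yes adjacent = adjacent

  ball-mono-≤ : ∀ {k l x} → k ℕ.≤ l → ball k x ≡ true → ball l x ≡ true
  ball-mono-≤ k≤l = mono (ℕP.≤⇒≤′ k≤l)
    where
    mono : ∀ {k l x} → k ℕ.≤′ l → ball k x ≡ true → ball l x ≡ true
    mono ℕ.≤′-refl        x∈ = x∈
    mono {l = suc l} (ℕ.≤′-step k≤′l) x∈ = ball-suc {l} (mono k≤′l x∈)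

  pathLength : ∀ {x y} → Reach C x y → ℕ
  pathLength here       = 0
  pathLength (step _ p) = suc (pathLength p)

  ball-path : ∀ {x} (p : Reach C x v₀) → ball (pathLength p) x ≡ true
  ball-path here       = ball-root 0
  ball-path (step a p) = ball-step {pathLength p} (ball-path p) a

  ball-covers : ∃ λ K → ∀ x → ball K x ≡ true
  ball-covers =
    let (K , length≤K) = upper-bound (λ x → pathLength (connected x v₀))
    in K , λ x → ball-mono-≤ (length≤K x) (ball-path (connected x v₀))

  outside : ℕ → Fin n → Bool
  outside k = not ∘ ball k

  -- Each stage multiplies the previous potential by Q, large enough to absorb the
  -- degree loss on the ball, and adds the indicator of the complement of the ball,
  -- whose Laplacian is at least w₀ on the next layer.
  potential : ℕ → Fin n → ℕ
  potential zero    _ = 0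
  potential (suc k) y = Q ℕ.* potential k y ℕ.+ (if outside k y then 1 else 0)

  ΔP : ℕ → Fin n → ℚ
  ΔP k = Δ C (λ y → + potential k y)

  potential-root : ∀ k → potential k v₀ ≡ 0
  potential-root zero    = refl
  potential-root (suc k) = cong₂ ℕ._+_ (trans (cong (Q ℕ.*_) (potential-root k)) (ℕP.*-zeroʳ Q))
                                      (cong (λ b → if not b then 1 else 0) (ball-root k))

  ΔP-suc : ∀ k x → ΔP (suc k) x ≡ ι (+ Q) * ΔP k x + Δ C (indicator (outside k)) x
  ΔP-suc k x = begin
    ΔP (suc k) x                                                          ≡⟨ Δ-cong C split x ⟩
    Δ C (λ y → + Q ℤ.* + potential k y ℤ.+ indicator (outside k) y) x     ≡⟨ Δ-homo-+ C (λ y → + Q ℤ.* + potential k y) (indicator (outside k)) x ⟩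
    Δ C (λ y → + Q ℤ.* + potential k y) x + Δ C (indicator (outside k)) x ≡⟨ cong (_+ Δ C (indicator (outside k)) x) (Δ-homo-* C (+ Q) (λ y → + potential k y) x) ⟩
    ι (+ Q) * ΔP k x + Δ C (indicator (outside k)) x                      ∎
    where
    open ≡-Reasoning
    split : ∀ y → + potential (suc k) y ≡ + Q ℤ.* + potential k y ℤ.+ indicator (outside k) y
    split y = trans (ℤP.pos-+ (Q ℕ.* potential k y) _) (cong (ℤ._+ indicator (outside k) y) (ℤP.pos-* Q (potential k y)))

  module _ {k x} (x∉ : ball k x ≡ false) where

    Δoutside-inward : Δ C (indicator (outside k)) x ≡ Σᶠ (λ y → if outside k y then 0ℚ else C x y)
    Δoutside-inward = Δ-indicator-true C (outside k) x (cong not x∉)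

    inward-nonNeg : ∀ y → 0ℚ ≤ (if outside k y then 0ℚ else C x y)
    inward-nonNeg y with outside k y
    ... | true  = ℚP.≤-refl
    ... | false = C≥0 x y

    Δoutside-nonNeg : 0ℚ ≤ Δ C (indicator (outside k)) x
    Δoutside-nonNeg = subst (0ℚ ≤_) (sym Δoutside-inward) (Σᶠ-nonNeg inward-nonNeg)

    Δoutside-edge : ∀ {y} → ball k y ≡ true → C x y ≤ Δ C (indicator (outside k)) x
    Δoutside-edge {y} y∈ = subst₂ _≤_ (cong (λ b → if not b then 0ℚ else C x y) y∈) (sym Δoutside-inward)
                                      (term≤Σᶠ inward-nonNeg y)

  Superharmonic : ℕ → Set
  Superharmonic k = (∀ x → ball k x ≡ true → x ≢ v₀ → w₀ ≤ ΔP k x)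
                  × (∀ x → ball k x ≡ false → 0ℚ ≤ ΔP k x)

  superharmonic : ∀ k → Superharmonic k
  superharmonic zero =
    (λ x x∈ x≢v₀ → ⊥-elim (x≢v₀ (ball-zero x∈))) , (λ x _ → ℚP.≤-reflexive (sym (Δ-const C (+ 0) x)))
  superharmonic (suc k) = on-ball , off-ball
    where
    on-ballₖ  = proj₁ (superharmonic k)
    off-ballₖ = proj₂ (superharmonic k)
    Δout : Fin n → ℚ
    Δout = Δ C (indicator (outside k))
    Q*ΔPₖ-nonNeg : ∀ {x} → ball k x ≡ false → 0ℚ ≤ ι (+ Q) * ΔP k x
    Q*ΔPₖ-nonNeg x∉ = 0≤p*q (ι-nonNeg Q) (off-ballₖ _ x∉)

    on-ball : ∀ x → ball (suc k) x ≡ true → x ≢ v₀ → w₀ ≤ ΔP (suc k) x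
    on-ball x x∈ x≢v₀ = subst (w₀ ≤_) (sym (ΔP-suc k x)) (by-cases (ball k x) refl)
      where
      by-cases : ∀ b → ball k x ≡ b → w₀ ≤ ι (+ Q) * ΔP k x + Δout x
      by-cases true x∈ₖ = begin
        w₀                                     ≡⟨ solve 2 (λ w d → w := (w :+ d) :+ :- d) refl w₀ totalDegree ⟩
        (w₀ + totalDegree) + - totalDegree     ≤⟨ ℚP.+-monoˡ-≤ (- totalDegree) w₀+totalDegree≤Qw₀ ⟩
        ι (+ Q) * w₀ + - totalDegree           ≤⟨ ℚP.+-mono-≤ (*-monoʳ-≤-0≤ (ι-nonNeg Q) (on-ballₖ x x∈ₖ x≢v₀))
                                                  (ℚP.≤-trans (ℚP.neg-antimono-≤ (degree≤totalDegree x))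
                                                              (-degree≤Δ-indicator C C≥0 (outside k) x)) ⟩
        ι (+ Q) * ΔP k x + Δout x              ∎
        where open ℚP.≤-Reasoning
      by-cases false x∉ₖ =
        let (y , y∈ₖ , 0<Cxy) = ball-new {k} x∈ x∉ₖ
        in ℚP.≤-trans (ℚP.≤-trans (w₀≤C x y 0<Cxy) (Δoutside-edge {k} x∉ₖ y∈ₖ)) (q≤p+q (Q*ΔPₖ-nonNeg x∉ₖ))

    off-ball : ∀ x → ball (suc k) x ≡ false → 0ℚ ≤ ΔP (suc k) x
    off-ball x x∉ = subst (0ℚ ≤_) (sym (ΔP-suc k x))
      (ℚP.≤-trans (Δoutside-nonNeg {k} x∉ₖ) (q≤p+q (Q*ΔPₖ-nonNeg x∉ₖ)))
      where
      x∉ₖ : ball k x ≡ false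
      x∉ₖ = ball-suc⁻ {k} x∉

  superharmonic-potential : ∃ λ (G : Fin n → ℕ) → G v₀ ≡ 0 ×
                              ∃ λ c → 0ℚ < c × (∀ x → x ≢ v₀ → c ≤ Δ C (λ y → + G y) x)
  superharmonic-potential =
    let (K , ball-K) = ball-covers
    in potential K , potential-root K , w₀ , w₀>0 , λ x x≢v₀ → proj₁ (superharmonic K) x (ball-K x) x≢v₀

-- Existence by firing legal sets

+-cancelʳ-< : ∀ {p q} r → p + r < q + r → p < q
+-cancelʳ-< {p} {q} r p+r<q+r = subst₂ _<_ (cancel p) (cancel q) (ℚP.+-monoˡ-< (- r) p+r<q+r)
  where
  cancel : ∀ s → s + r - r ≡ s
  cancel s = solve 2 (λ s r → s :+ r :- r := s) refl s r

descent : ∀ {S : Set} (P R : S → Set) (Φ : S → ℚ) (b c : ℚ) → 0ℚ < c →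
          (∀ s → P s → b ≤ Φ s) →
          (∀ s → P s → R s ⊎ ∃ λ s′ → P s′ × Φ s′ + c ≤ Φ s) →
          ∀ s → P s → ∃ λ s′ → P s′ × R s′
descent P R Φ b c 0<c b≤Φ progress s Ps =
  let (N , Φs-b≤Nc) = archimedean (Φ s - b) c 0<c
  in run (suc N) s Ps (begin-strict
       Φ s                        ≡⟨ solve 2 (λ φ b → φ := b :+ (φ :- b)) refl (Φ s) b ⟩
       b + (Φ s - b)              ≤⟨ ℚP.+-monoʳ-≤ b Φs-b≤Nc ⟩
       b + ι (+ N) * c            <⟨ ℚP.+-monoʳ-< b (p<p+q 0<c) ⟩
       b + (ι (+ N) * c + c)      ≡⟨ next-fuel N ⟨
       b + ι (+ suc N) * c        ∎)
  where
  open ℚP.≤-Reasoning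
  next-fuel : ∀ N → b + ι (+ suc N) * c ≡ b + (ι (+ N) * c + c)
  next-fuel N = trans (cong (λ t → b + t * c) (ι-homo-+ (+ 1) (+ N)))
                      (solve 3 (λ b m c → b :+ (con (+ 1) :+ m) :* c := b :+ (m :* c :+ c)) refl b (ι (+ N)) c)
  run : ∀ N s → P s → Φ s < b + ι (+ N) * c → ∃ λ s′ → P s′ × R s′
  run zero    s Ps Φs<b+0 = ⊥-elim (ℚP.<-irrefl refl (ℚP.<-≤-trans
                              (subst (Φ s <_) (solve 2 (λ b c → b :+ con (+ 0) :* c := b) refl b c) Φs<b+0) (b≤Φ s Ps)))
  run (suc N) s Ps Φs<b+Nc with progress s Ps
  ... | inj₁ Rs = s , Ps , Rs
  ... | inj₂ (s′ , Ps′ , Φs′+c≤Φs) = run N s′ Ps′ (+-cancelʳ-< c (begin-strict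
          Φ s′ + c              ≤⟨ Φs′+c≤Φs ⟩
          Φ s                   <⟨ Φs<b+Nc ⟩
          b + ι (+ suc N) * c   ≡⟨ next-fuel N ⟩
          b + (ι (+ N) * c + c) ≡⟨ ℚP.+-assoc b (ι (+ N) * c) c ⟨
          b + ι (+ N) * c + c   ∎))

module Existence {n : ℕ} (C : Weights n) (C-sym : ∀ x y → C x y ≡ C y x) (C≥0 : ∀ x y → 0ℚ ≤ C x y)
                 (connected : Connected C) (v₀ : Fin n) (D : Fin n → ℚ) where

  D+Δ : (Fin n → ℤ) → Fin n → ℚ
  D+Δ f x = D x + Δ C f x

  private
    superharmonic = Potential.superharmonic-potential C C≥0 connected v₀

  G : Fin n → ℤ
  G y = + proj₁ superharmonic y

  G-nonNeg : ∀ x → 0ℚ ≤ ι (G x)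
  G-nonNeg x = ι-nonNeg (proj₁ superharmonic x)

  G-root : G v₀ ≡ + 0
  G-root = cong +_ (proj₁ (proj₂ superharmonic))

  c : ℚ
  c = proj₁ (proj₂ (proj₂ superharmonic))

  c>0 : 0ℚ < c
  c>0 = proj₁ (proj₂ (proj₂ (proj₂ superharmonic)))

  c≤ΔG : ∀ x → x ≢ v₀ → c ≤ Δ C G x
  c≤ΔG = proj₂ (proj₂ (proj₂ (proj₂ superharmonic)))

  LegallyFireable : (Fin n → ℤ) → Subset n → Set
  LegallyFireable f A = Nonempty A × v₀ ∉ A × (∀ x → x ∈ A → outdeg C A x ≤ D+Δ f x)

  legallyFireable? : ∀ f A → Dec (LegallyFireable f A)
  legallyFireable? f A = nonempty? A ×-dec ¬? (v₀ ∈? A)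
                           ×-dec all? (λ x → (x ∈? A) →-dec (outdeg C A x ℚP.≤? D+Δ f x))

  unfireable : ∀ f → ¬ (∃ (LegallyFireable f)) → Unfireable C v₀ (D+Δ f)
  unfireable f ¬fireable A A≢∅ v₀∉A =
    let (x , ¬[x∈A→outdeg≤]) = ¬∀⟶∃¬ n _ (λ x → (x ∈? A) →-dec (outdeg C A x ℚP.≤? D+Δ f x))
                                  (λ outdeg≤ → ¬fireable (A , A≢∅ , v₀∉A , outdeg≤))
    in x , decidable-stable (x ∈? A) (λ x∉A → ¬[x∈A→outdeg≤] (λ x∈A → ⊥-elim (x∉A x∈A)))
         , ℚP.≰⇒> (λ outdeg≤ → ¬[x∈A→outdeg≤] (λ _ → outdeg≤))

  fire : (Fin n → ℤ) → Subset n → Fin n → ℤ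
  fire f A y = f y ℤ.- indicator (lookup A) y

  D+Δ-fire : ∀ f A x → D+Δ (fire f A) x ≡ D+Δ f x - Δ C (indicator (lookup A)) x
  D+Δ-fire f A x = trans (cong (λ t → D x + t) (Δ-homo-- C f (indicator (lookup A)) x))
    (solve 3 (λ d a b → d :+ (a :- b) := (d :+ a) :- b) refl (D x) (Δ C f x) (Δ C (indicator (lookup A)) x))

  fire-effective : ∀ {f A} → LegallyFireable f A → EffectiveAway v₀ (D+Δ f) → EffectiveAway v₀ (D+Δ (fire f A))
  fire-effective {f} {A} (_ , _ , outdeg≤) D+Δf≥0 x x≢v₀ =
    subst (0ℚ ≤_) (sym (D+Δ-fire f A x)) (by-cases (lookup A x) refl)
    where
    by-cases : ∀ b → lookup A x ≡ b → 0ℚ ≤ D+Δ f x - Δ C (indicator (lookup A)) x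
    by-cases true  x∈A = subst (λ t → 0ℚ ≤ D+Δ f x - t) (sym (Δ-indicator-true C (lookup A) x x∈A))
                           (p≤q⇒0≤q-p (outdeg≤ x (Vec.lookup⇒[]= x A x∈A)))
    by-cases false x∉A = ℚP.≤-trans (D+Δf≥0 x x≢v₀)
                           (p≤p+q (ℚP.neg-antimono-≤ (Δ-indicator-false C C≥0 (lookup A) x x∉A)))

  energy : (Fin n → ℤ) → ℚ
  energy f = Σᶠ (λ x → ι (f x) * Δ C G x)

  energy-fire : ∀ {f A} → LegallyFireable f A → energy (fire f A) + c ≤ energy f
  energy-fire {f} {A} ((a , a∈A) , v₀∉A , _) = begin
    energy (fire f A) + c     ≡⟨ cong (_+ c) energy-split ⟩
    energy f - fired + c      ≤⟨ ℚP.+-monoʳ-≤ (energy f - fired) c≤fired ⟩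
    energy f - fired + fired  ≡⟨ solve 2 (λ e φ → e :- φ :+ φ := e) refl (energy f) fired ⟩
    energy f                  ∎
    where
    open ℚP.≤-Reasoning
    fired-term : Fin n → ℚ
    fired-term x = ι (indicator (lookup A) x) * Δ C G x
    fired = Σᶠ fired-term
    energy-split : energy (fire f A) ≡ energy f - fired
    energy-split = trans (Σᶠ-cong split) (Σᶠ-distrib-- (λ x → ι (f x) * Δ C G x) fired-term)
      where
      split : ∀ x → ι (fire f A x) * Δ C G x ≡ ι (f x) * Δ C G x - fired-term x
      split x = trans (cong (_* Δ C G x) (ι-homo-- (f x) (indicator (lookup A) x)))
        (solve 3 (λ p q g → (p :- q) :* g := p :* g :- q :* g) refl (ι (f x)) (ι (indicator (lookup A) x)) (Δ C G x))
    fired-term-nonNeg : ∀ x → 0ℚ ≤ fired-term x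
    fired-term-nonNeg x = by-cases (lookup A x) refl
      where
      by-cases : ∀ b → lookup A x ≡ b → 0ℚ ≤ fired-term x
      by-cases true  x∈A rewrite x∈A = 0≤p*q (ι-nonNeg 1) (ℚP.≤-trans (ℚP.<⇒≤ c>0)
        (c≤ΔG x (λ x≡v₀ → v₀∉A (subst (_∈ A) x≡v₀ (Vec.lookup⇒[]= x A x∈A)))))
      by-cases false x∉A rewrite x∉A = ℚP.≤-reflexive (sym (ℚP.*-zeroˡ (Δ C G x)))
    c≤fired : c ≤ fired
    c≤fired = begin
      c            ≤⟨ c≤ΔG a (λ a≡v₀ → v₀∉A (subst (_∈ A) a≡v₀ a∈A)) ⟩
      Δ C G a      ≡⟨ trans (cong (λ b → ι (+ (if b then 1 else 0)) * Δ C G a) (Vec.[]=⇒lookup a∈A))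
                            (ℚP.*-identityˡ (Δ C G a)) ⟨
      fired-term a ≤⟨ term≤Σᶠ fired-term-nonNeg a ⟩
      fired        ∎

  E : ℚ
  E = Σᶠ (λ x → ι (G x) * D x)

  energy-lowerBound : ∀ f → EffectiveAway v₀ (D+Δ f) → - E ≤ energy f
  energy-lowerBound f D+Δf≥0 = begin
    - E                                            ≡⟨ ℚP.+-identityˡ (- E) ⟨
    0ℚ - E                                         ≤⟨ ℚP.+-monoˡ-≤ (- E) (Σᶠ-nonNeg term-nonNeg) ⟩
    Σᶠ (λ x → ι (G x) * D+Δ f x) - E               ≡⟨ cong (_- E) expand ⟩
    E + Σᶠ (λ x → ι (G x) * Δ C f x) - E           ≡⟨ solve 2 (λ e s → e :+ s :- e := s) refl E _ ⟩
    Σᶠ (λ x → ι (G x) * Δ C f x)                   ≡⟨ Δ-selfAdjoint C C-sym G f ⟩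
    energy f                                       ∎
    where
    open ℚP.≤-Reasoning
    expand : Σᶠ (λ x → ι (G x) * D+Δ f x) ≡ E + Σᶠ (λ x → ι (G x) * Δ C f x)
    expand = trans (Σᶠ-cong (λ x → ℚP.*-distribˡ-+ (ι (G x)) (D x) (Δ C f x)))
                   (Σᶠ-distrib-+ (λ x → ι (G x) * D x) (λ x → ι (G x) * Δ C f x))
    term-nonNeg : ∀ x → 0ℚ ≤ ι (G x) * D+Δ f x
    term-nonNeg x with x ≟ v₀
    ... | yes refl  = ℚP.≤-reflexive (sym (trans (cong (λ g → ι g * D+Δ f v₀) G-root) (ℚP.*-zeroˡ (D+Δ f v₀))))
    ... | no  x≢v₀ = 0≤p*q (G-nonNeg x) (D+Δf≥0 x x≢v₀)

  effective-start : ∃ λ f → EffectiveAway v₀ (D+Δ f)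
  effective-start = f₀ , f₀-effective
    where
    mass : ℚ
    mass = Σᶠ (λ x → ∣ D x ∣)
    K = proj₁ (archimedean mass c c>0)
    f₀ : Fin n → ℤ
    f₀ y = + K ℤ.* G y
    f₀-effective : EffectiveAway v₀ (D+Δ f₀)
    f₀-effective x x≢v₀ = begin
      0ℚ                      ≤⟨ 0≤p+∣p∣ (D x) ⟩
      D x + ∣ D x ∣           ≤⟨ ℚP.+-monoʳ-≤ (D x) (term≤Σᶠ (λ y → ℚP.0≤∣p∣ (D y)) x) ⟩
      D x + mass              ≤⟨ ℚP.+-monoʳ-≤ (D x) (proj₂ (archimedean mass c c>0)) ⟩
      D x + ι (+ K) * c       ≤⟨ ℚP.+-monoʳ-≤ (D x) (*-monoʳ-≤-0≤ (ι-nonNeg K) (c≤ΔG x x≢v₀)) ⟩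
      D x + ι (+ K) * Δ C G x ≡⟨ cong (λ t → D x + t) (Δ-homo-* C (+ K) G x) ⟨
      D+Δ f₀ x                ∎
      where open ℚP.≤-Reasoning

  reduced-exists : ∃ λ f → IsReduced C v₀ (D+Δ f)
  reduced-exists =
    let (f₀ , f₀-effective) = effective-start
        (f , f-effective , f-unfireable) =
          descent (EffectiveAway v₀ ∘ D+Δ) (Unfireable C v₀ ∘ D+Δ) energy (- E) c c>0
                  energy-lowerBound fire-or-stop f₀ f₀-effective
    in f , f-effective , f-unfireable
    where
    fire-or-stop : ∀ f → EffectiveAway v₀ (D+Δ f) →
                   Unfireable C v₀ (D+Δ f) ⊎ ∃ λ f′ → EffectiveAway v₀ (D+Δ f′) × energy f′ + c ≤ energy f
    fire-or-stop f f-effective with anySubset? (legallyFireable? f)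
    ... | yes (A , legal) = inj₂ (fire f A , fire-effective {f} legal f-effective , energy-fire {f} legal)
    ... | no  ¬legal      = inj₁ (unfireable f ¬legal)

proposition2p6 : (n : ℕ) (C : Weights n) → IsWeightedGraph C → Connected C →
    (v₀ : Fin n) (i : Fin n → ℚ) → (∀ x → IsIndex C x (i x)) →
    (ℓ : Fin n → ℤ) →
    ∃ λ (ℓ₀ : Fin n → ℤ) → Reduced C i v₀ ℓ₀ × Equiv C i ℓ ℓ₀
      × (∀ (ℓ₁ : Fin n → ℤ) → Reduced C i v₀ ℓ₁ → Equiv C i ℓ ℓ₁ →
           ∀ x → divAt i ℓ₁ x ≡ divAt i ℓ₀ x)
proposition2p6 n C (C-sym , C≥0 , _) connected v₀ i i-index ℓ =
  ℓ₀ , ℓ₀-reduced , (f , ℓ₀≡ℓ+Δf) , unique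
  where
  open Existence C C-sym C≥0 connected v₀ (divAt i ℓ) using (reduced-exists)
  f = proj₁ reduced-exists
  ℓ₀ = proj₁ (divAt-+Δ C i-index ℓ f)
  ℓ₀≡ℓ+Δf = proj₂ (divAt-+Δ C i-index ℓ f)
  ℓ₀-reduced : Reduced C i v₀ ℓ₀
  ℓ₀-reduced = IsReduced-resp-≗ (sym ∘ ℓ₀≡ℓ+Δf) (proj₂ reduced-exists)
  unique : ∀ ℓ₁ → Reduced C i v₀ ℓ₁ → Equiv C i ℓ ℓ₁ → ∀ x → divAt i ℓ₁ x ≡ divAt i ℓ₀ x
  unique ℓ₁ ℓ₁-reduced (f₁ , ℓ₁≡ℓ+Δf₁) =
    IsReduced-unique C C≥0 v₀ (divAt i ℓ₀) (divAt i ℓ₁) (λ y → f₁ y ℤ.- f y) ℓ₀-reduced ℓ₁-reduced ℓ₁≡ℓ₀+Δ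
    where
    ℓ₁≡ℓ₀+Δ : ∀ x → divAt i ℓ₁ x ≡ divAt i ℓ₀ x + Δ C (λ y → f₁ y ℤ.- f y) x
    ℓ₁≡ℓ₀+Δ x = trans (ℓ₁≡ℓ+Δf₁ x) (sym (trans (cong₂ _+_ (ℓ₀≡ℓ+Δf x) (Δ-homo-- C f₁ f x))
      (solve 3 (λ d a b → (d :+ b) :+ (a :- b) := d :+ a) refl (divAt i ℓ x) (Δ C f₁ x) (Δ C f x))))
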